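{- Let $j \in \mathbb{N}_0$ and $r \in \mathbb{Z}$. Then, pointwise on $\mathbb{N}$, $$d_r = \sum_{k=0}^{\infty} \binom{k+r-1}{k} c_k^{(-k)}.$$ More generally, for any $u \in \mathbb{N}_0$ and $v \in \mathbb{Z}$, $$c_{j+u}^{(r+v)} = \sum_{k=j}^{\infty} \binom{k+r-1}{k-j} c_{u+k}^{(v-k)}.$$
   Context: Arithmetic functions are maps $\mathbb{N} \to \mathbb{C}$ with Dirichlet convolution $(f*g)(n) = \sum_{n_1 n_2 = n} f(n_1) g(n_2)$. Write $f^{*j}$ for the $j$-fold convolution power, with $f^{*0} = e$, where $e(n) = \delta_{n,1}$. Let $1$ denote the constant function $1$ and $\mu$ the Möbius function; for negative integers $-r$ set $1^{*(-r)} = \mu^{*r}$. The divisor function $d_r$ is $d_r = 1^{*r}$ for $r \in \mathbb{Z}$. For $j \in \mathbb{N}_0$, $r \in \mathbb{Z}$, the associated divisor function is $c_j^{(r)} = (1-e)^{*j} * 1^{*r}$. Binomial coefficients with integer (possibly negative) upper entry are the generalized ones $\binom{x}{a} = x(x-1)\cdots(x-a+1)/a!$ for $a\in\mathbb{N}_0$. For each fixed $n$ only finitely many terms of the series are nonzero. -}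

module Defs where

open import Data.Nat as ℕ using (ℕ; zero; suc; _!; NonZero)
open import Data.Nat.Properties using (_!≢0)
open import Data.Nat.Divisibility using (_∣?_)
open import Data.Nat.Primality using (prime?)
open import Data.Integer as ℤ using (ℤ; +_; -[1+_]; _+_; _*_; _-_; -_; 0ℤ; 1ℤ; _/ℕ_)
open import Data.List using (List; length; filter; upTo)
open import Data.List.Relation.Unary.Any using (any?)
open import Relation.Nullary using (does; _×-dec_)
open import Data.Bool using (if_then_else_)
open import Data.Product using (∃; _×_)
open import Relation.Binary.PropositionalEquality using (_≡_)

-- Arithmetic functions; only the values at n ≥ 1 are meaningful
-- (the value at 0 is irrelevant). Integer-valued suffices here: all
-- functions in the statement are integer-valued.
ArithFun : Set
ArithFun = ℕ → ℤ

sumBelow : ℕ → (ℕ → ℤ) → ℤ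
sumBelow zero    f = 0ℤ
sumBelow (suc m) f = sumBelow m f + f m

-- Dirichlet convolution: (f ⋆ g)(n) = Σ_{d ∣ n, 1 ≤ d ≤ n} f(d) g(n/d)
_⋆_ : ArithFun → ArithFun → ArithFun
(f ⋆ g) n = sumBelow n (λ i →
  if does (suc i ∣? n) then f (suc i) * g (n ℕ./ suc i) else 0ℤ)

e : ArithFun
e n = if does (n ℕ.≟ 1) then 1ℤ else 0ℤ

one : ArithFun
one _ = 1ℤ

_−ᶠ_ : ArithFun → ArithFun → ArithFun
(f −ᶠ g) n = f n - g n

ω : ℕ → ℕ
ω n = length (filter (λ p → prime? p ×-dec (p ∣? n)) (upTo (suc n)))

negOnePow : ℕ → ℤ
negOnePow zero    = 1ℤ
negOnePow (suc k) = - negOnePow k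

μ : ArithFun
μ n = if does (any? (λ m → (2 ℕ.≤? m) ×-dec (m ℕ.* m ∣? n)) (upTo (suc n)))
      then 0ℤ else negOnePow (ω n)

_^⋆_ : ArithFun → ℕ → ArithFun
f ^⋆ zero  = e
f ^⋆ suc j = f ⋆ (f ^⋆ j)

-- 1^{*r} for r ∈ ℤ, with 1^{*(-r)} = μ^{*r}
onePow : ℤ → ArithFun
onePow (+ r)     = one ^⋆ r
onePow -[1+ r ]  = μ ^⋆ suc r

d : ℤ → ArithFun
d r = onePow r

c : ℕ → ℤ → ArithFun
c j r = ((one −ᶠ e) ^⋆ j) ⋆ onePow r

falling : ℤ → ℕ → ℤ
falling x zero    = 1ℤ
falling x (suc a) = falling x a * (x - + a)

-- generalized binomial coefficient (x choose a) = falling x a / a!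
-- (the division is exact)
binom : ℤ → ℕ → ℤ
binom x a = _/ℕ_ (falling x a) (a !) {{a !≢0}}

-- The series Σ_{k ≥ j} t(k) (finitely many nonzero terms) equals v:
-- its partial sums Σ_{k=j}^{j+M-1} t(k) are eventually equal to v.
SeriesFrom : ℕ → (ℕ → ℤ) → ℤ → Set
SeriesFrom j t v =
  ∃ λ K → (M : ℕ) → K ℕ.≤ M → sumBelow M (λ i → t (j ℕ.+ i)) ≡ v

module Submission where

-- Put γ = (1 - e) ⋆ μ. Möbius inversion μ ⋆ 1 = e gives μ = e - γ and 1^{*s} = (e - γ)^{-s},
-- while c_k^{(-k)} = (1 - e)^{*k} ⋆ μ^{*k} = γ^{*k}. So the first identity is the negative
-- binomial series 1^{*s} = Σ_k (k+s-1 choose k) γ^{*k}; since γ(1) = 0, γ^{*k} vanishes at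
-- 1, …, k and every series is finite at each n.
--
-- Finally the general identity follows by reindexing k = j + i,
-- as c_{u+j+i}^{(v-j-i)} = γ^{*i} ⋆ c_{u+j}^{(v-j)}, and the first one is its case j = u = v = 0.

open import Defs
open import Data.Nat as ℕ using (ℕ; zero; suc; _≤_; _<_; _∸_; z≤n; s≤s; NonZero; _!) renaming (_+_ to _+ℕ_; _*_ to _*ℕ_)
import Data.Nat.Properties as ℕP
open import Data.Nat.DivMod using (n/1≡n; m*n/n≡m; m*n%n≡0)
open import Data.Nat.Divisibility
open import Data.Nat.Primality
open import Data.Nat.Coprimality using (Coprime; coprime-divisor)
open import Data.Nat.Primality.Factorisation using (factorise)
open import Data.Nat.ListAction using (product)
open import Data.Nat.Combinatorics using (_C_; nCk+nC[k+1]≡[n+1]C[k+1]; k>n⇒nCk≡0)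
import Data.Nat.Tactic.RingSolver as ℕ-Solver
open import Data.Integer using (ℤ; +_; -[1+_]; -_; _+_; _-_; _*_; 0ℤ; 1ℤ; _/ℕ_)
import Data.Integer.Properties as ℤP
open import Data.Integer.Tactic.RingSolver using (solve-∀)
open import Data.Bool using (Bool; true; false; not; if_then_else_)
open import Data.List using ([]; _∷_; length; filter; upTo; _++_)
import Data.List.Properties as List
open import Data.List.Relation.Unary.Any using (Any; any?)
import Data.List.Relation.Unary.Any.Properties as Any
open import Data.List.Relation.Unary.All using (_∷_)
open import Data.Product using (∃; ∃₂; _,_; _×_)
open import Data.Sum using (inj₁; inj₂; [_,_])
open import Data.Empty using (⊥-elim)
open import Relation.Nullary using (Dec; ¬_; yes; no; does; _×-dec_)
open import Relation.Nullary.Decidable using (dec-true; dec-false; does-⇔)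
open import Function using (mk⇔)
open import Relation.Binary.PropositionalEquality hiding ([_])
open import Relation.Binary.Bundles using (Setoid)
import Relation.Binary.Reasoning.Setoid as SetoidReasoning

sum-cong : ∀ N {t t' : ℕ → ℤ} → (∀ i → i < N → t i ≡ t' i) → sumBelow N t ≡ sumBelow N t'
sum-cong zero    eq = refl
sum-cong (suc N) eq = cong₂ _+_ (sum-cong N (λ i i<N → eq i (ℕP.m<n⇒m<1+n i<N))) (eq N ℕP.≤-refl)

sum-zero : ∀ N {t : ℕ → ℤ} → (∀ i → i < N → t i ≡ 0ℤ) → sumBelow N t ≡ 0ℤ
sum-zero zero    h = refl
sum-zero (suc N) h = cong₂ _+_ (sum-zero N (λ i i<N → h i (ℕP.m<n⇒m<1+n i<N))) (h N ℕP.≤-refl)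

sum-+ : ∀ N (t t' : ℕ → ℤ) → sumBelow N (λ i → t i + t' i) ≡ sumBelow N t + sumBelow N t'
sum-+ zero    t t' = refl
sum-+ (suc N) t t' = trans (cong (_+ (t N + t' N)) (sum-+ N t t'))
                           (interchange (sumBelow N t) (sumBelow N t') (t N) (t' N))
  where interchange : ∀ a b c d → a + b + (c + d) ≡ a + c + (b + d)
        interchange = solve-∀

sum-*ˡ : ∀ N a (t : ℕ → ℤ) → a * sumBelow N t ≡ sumBelow N (λ i → a * t i)
sum-*ˡ zero    a t = ℤP.*-zeroʳ a
sum-*ˡ (suc N) a t = trans (ℤP.*-distribˡ-+ a (sumBelow N t) (t N)) (cong (_+ a * t N) (sum-*ˡ N a t))

sum-*ʳ : ∀ N a (t : ℕ → ℤ) → sumBelow N t * a ≡ sumBelow N (λ i → t i * a)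
sum-*ʳ N a t = trans (ℤP.*-comm (sumBelow N t) a)
                     (trans (sum-*ˡ N a t) (sum-cong N (λ i _ → ℤP.*-comm a (t i))))

sum-neg : ∀ N (t : ℕ → ℤ) → - sumBelow N t ≡ sumBelow N (λ i → - t i)
sum-neg zero    t = refl
sum-neg (suc N) t = trans (ℤP.neg-distrib-+ (sumBelow N t) (t N)) (cong (_+ - t N) (sum-neg N t))

sum-swap : ∀ N M (t : ℕ → ℕ → ℤ) →
           sumBelow N (λ i → sumBelow M (t i)) ≡ sumBelow M (λ j → sumBelow N (λ i → t i j))
sum-swap zero    M t = sym (sum-zero M (λ _ _ → refl))
sum-swap (suc N) M t = trans (cong (_+ sumBelow M (t N)) (sum-swap N M t))
                             (sym (sum-+ M (λ j → sumBelow N (λ i → t i j)) (t N)))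

sum-single : ∀ N k {t : ℕ → ℤ} → k < N → (∀ i → i < N → i ≢ k → t i ≡ 0ℤ) → sumBelow N t ≡ t k
sum-single (suc N) k {t} k<1+N h with ℕP.m<1+n⇒m<n∨m≡n k<1+N
... | inj₁ k<N  = trans (cong₂ _+_ (sum-single N k k<N (λ i i<N → h i (ℕP.m<n⇒m<1+n i<N)))
                                  (h N ℕP.≤-refl (λ N≡k → ℕP.<⇒≢ k<N (sym N≡k))))
                        (ℤP.+-identityʳ (t k))
... | inj₂ refl = trans (cong (_+ t k) (sum-zero N (λ i i<N → h i (ℕP.m<n⇒m<1+n i<N) (ℕP.<⇒≢ i<N))))
                        (ℤP.+-identityˡ (t k))

sum-pad : ∀ {N M} (t : ℕ → ℤ) → N ≤ M → (∀ i → N ≤ i → t i ≡ 0ℤ) → sumBelow M t ≡ sumBelow N t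
sum-pad {N} {zero}  t z≤n  h = refl
sum-pad {N} {suc M} t N≤1+M h with ℕP.m≤n⇒m<n∨m≡n N≤1+M
... | inj₁ N≤M  = trans (cong₂ _+_ (sum-pad t (ℕP.≤-pred N≤M) h) (h M (ℕP.≤-pred N≤M)))
                        (ℤP.+-identityʳ (sumBelow N t))
... | inj₂ refl = refl

-- `guard b x` is x if b holds and 0 otherwise: every convolution summand has this shape.
guard : Bool → ℤ → ℤ
guard b x = if b then x else 0ℤ

guard-0 : ∀ b → guard b 0ℤ ≡ 0ℤ
guard-0 true  = refl
guard-0 false = refl

guard-+ : ∀ b x y → guard b (x + y) ≡ guard b x + guard b y
guard-+ true  x y = refl
guard-+ false x y = refl

guard-neg : ∀ b x → guard b (- x) ≡ - guard b x
guard-neg true  x = refl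
guard-neg false x = refl

guard-*ˡ : ∀ b a x → a * guard b x ≡ guard b (a * x)
guard-*ˡ true  a x = refl
guard-*ˡ false a x = ℤP.*-zeroʳ a

guard-*ʳ : ∀ b a x → guard b x * a ≡ guard b (x * a)
guard-*ʳ true  a x = refl
guard-*ʳ false a x = ℤP.*-zeroˡ a

guard-swap : ∀ a b x → guard a (guard b x) ≡ guard b (guard a x)
guard-swap true  b x = refl
guard-swap false b x = sym (guard-0 b)

guard-sum : ∀ b N (t : ℕ → ℤ) → guard b (sumBelow N t) ≡ sumBelow N (λ i → guard b (t i))
guard-sum true  N t = refl
guard-sum false N t = sym (sum-zero N (λ _ _ → refl))

guard-split : ∀ a b x → guard a (x * 1ℤ) ≡ guard a (guard (not b) x) + guard a (guard b x)
guard-split true  true  x = trans (ℤP.*-identityʳ x) (sym (ℤP.+-identityˡ x))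
guard-split true  false x = trans (ℤP.*-identityʳ x) (sym (ℤP.+-identityʳ x))
guard-split false b     x = refl

guard-yes : ∀ {P : Set} (P? : Dec P) x → P → guard (does P?) x ≡ x
guard-yes P? x p = cong (λ b → guard b x) (dec-true P? p)

guard-no : ∀ {P : Set} (P? : Dec P) x → ¬ P → guard (does P?) x ≡ 0ℤ
guard-no P? x ¬p = cong (λ b → guard b x) (dec-false P? ¬p)

ifEq : ℕ → ℕ → ℤ → ℤ
ifEq m n x = guard (does (m ℕ.≟ n)) x

ifEq-yes : ∀ {m n} x → m ≡ n → ifEq m n x ≡ x
ifEq-yes {m} {n} x = guard-yes (m ℕ.≟ n) x

ifEq-no : ∀ {m n} x → m ≢ n → ifEq m n x ≡ 0ℤ
ifEq-no {m} {n} x = guard-no (m ℕ.≟ n) x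

ifEq-0 : ∀ m n → ifEq m n 0ℤ ≡ 0ℤ
ifEq-0 m n = guard-0 (does (m ℕ.≟ n))

ifEq-cong : ∀ m n {x y} → (m ≡ n → x ≡ y) → ifEq m n x ≡ ifEq m n y
ifEq-cong m n x≡y with m ℕ.≡ᵇ n | ℕP.≡ᵇ⇒≡ m n
... | true  | m≡n = x≡y (m≡n _)
... | false | _   = refl

⋆-congˡ-upTo : ∀ {f f'} g n → (∀ m → 1 ≤ m → m ≤ n → f m ≡ f' m) → (f ⋆ g) n ≡ (f' ⋆ g) n
⋆-congˡ-upTo g n f≡f' = sum-cong n (λ i i<n →
  cong (λ z → guard (does (suc i ∣? n)) (z * g (n ℕ./ suc i))) (f≡f' (suc i) (s≤s z≤n) i<n))

_+ᶠ_ : ArithFun → ArithFun → ArithFun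
(f +ᶠ g) n = f n + g n

module _ (g : ArithFun) (n : ℕ) where

  private
    dvd : ℕ → Bool
    dvd i = does (suc i ∣? n)

    term : ArithFun → ℕ → ℤ
    term f i = guard (dvd i) (f (suc i) * g (n ℕ./ suc i))

  ⋆-distribʳ-+ : ∀ f f' → ((f +ᶠ f') ⋆ g) n ≡ (f ⋆ g) n + (f' ⋆ g) n
  ⋆-distribʳ-+ f f' = trans (sum-cong n split) (sum-+ n (term f) (term f'))
    where
    split : ∀ i → i < n → term (f +ᶠ f') i ≡ term f i + term f' i
    split i _ = trans (cong (guard (dvd i)) (ℤP.*-distribʳ-+ (g (n ℕ./ suc i)) (f (suc i)) (f' (suc i))))
                      (guard-+ (dvd i) _ _)

  ⋆-distribʳ-− : ∀ f f' → ((f −ᶠ f') ⋆ g) n ≡ (f ⋆ g) n - (f' ⋆ g) n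
  ⋆-distribʳ-− f f' =
    trans (sum-cong n split)
          (trans (sum-+ n (term f) (λ i → - term f' i)) (cong (_+_ ((f ⋆ g) n)) (sym (sum-neg n (term f')))))
    where
    split : ∀ i → i < n → term (f −ᶠ f') i ≡ term f i + - term f' i
    split i _ = trans (cong (guard (dvd i)) (trans (ℤP.*-distribʳ-+ (g (n ℕ./ suc i)) (f (suc i)) (- f' (suc i)))
                                             (cong (_+_ (f (suc i) * g (n ℕ./ suc i)))
                                                   (sym (ℤP.neg-distribˡ-* (f' (suc i)) (g (n ℕ./ suc i)))))))
                      (trans (guard-+ (dvd i) _ _) (cong (_+_ (term f i)) (guard-neg (dvd i) _)))

  ⋆-scaleˡ : ∀ a f → ((λ m → a * f m) ⋆ g) n ≡ a * (f ⋆ g) n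
  ⋆-scaleˡ a f = trans (sum-cong n scale) (sym (sum-*ˡ n a (term f)))
    where
    scale : ∀ i → i < n → term (λ m → a * f m) i ≡ a * term f i
    scale i _ = trans (cong (guard (dvd i)) (ℤP.*-assoc a (f (suc i)) (g (n ℕ./ suc i)))) (sym (guard-*ˡ (dvd i) a _))

  ⋆-zeroˡ : ((λ _ → 0ℤ) ⋆ g) n ≡ 0ℤ
  ⋆-zeroˡ = sum-zero n (λ i _ → trans (cong (guard (dvd i)) (ℤP.*-zeroˡ (g (n ℕ./ suc i)))) (guard-0 (dvd i)))

  ⋆-sumˡ : ∀ M (a : ℕ → ℤ) (F : ℕ → ArithFun) →
           ((λ m → sumBelow M (λ k → a k * F k m)) ⋆ g) n ≡ sumBelow M (λ k → a k * (F k ⋆ g) n)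
  ⋆-sumˡ zero    a F = ⋆-zeroˡ
  ⋆-sumˡ (suc M) a F =
    trans (⋆-distribʳ-+ (λ m → sumBelow M (λ k → a k * F k m)) (λ m → a M * F M m))
          (cong₂ _+_ (⋆-sumˡ M a F) (⋆-scaleˡ (a M) (F M)))

⋆-identityˡ-at : ∀ f n → 1 ≤ n → (e ⋆ f) n ≡ f n
⋆-identityˡ-at f n 1≤n = trans (sum-single n 0 1≤n others) unit
  where
  unit : guard (does (1 ∣? n)) (1ℤ * f (n ℕ./ 1)) ≡ f n
  unit = trans (guard-yes (1 ∣? n) _ (1∣ n))
               (trans (ℤP.*-identityˡ (f (n ℕ./ 1))) (cong f (n/1≡n n)))
  others : ∀ i → i < n → i ≢ 0 → guard (does (suc i ∣? n)) (e (suc i) * f (n ℕ./ suc i)) ≡ 0ℤ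
  others zero    _ i≢0 = ⊥-elim (i≢0 refl)
  others (suc i) _ _   = trans (cong (guard (does (suc (suc i) ∣? n))) (ℤP.*-zeroˡ (f (n ℕ./ suc (suc i)))))
                               (guard-0 (does (suc (suc i) ∣? n)))

Grid : ℕ → ℕ → (ℕ → ℕ → ℤ) → ℤ
Grid N n t = sumBelow N (λ a → sumBelow N (λ b → ifEq (suc a *ℕ suc b) n (t a b)))

factor<ʳ : ∀ a b {n} → suc a *ℕ suc b ≡ n → b < n
factor<ʳ a b refl = ℕP.m≤n*m (suc b) (suc a)

factor<ˡ : ∀ a b {n} → suc a *ℕ suc b ≡ n → a < n
factor<ˡ a b refl = ℕP.m≤m*n (suc a) (suc b)

Grid-pad : ∀ {N} n t → n ≤ N → Grid N n t ≡ Grid n n t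
Grid-pad {N} n t n≤N =
  trans (sum-cong N (λ a _ → sum-pad _ n≤N (λ b n≤b → ifEq-no _ (λ eq → ℕP.<⇒≱ (factor<ʳ a b eq) n≤b))))
        (sum-pad _ n≤N (λ a n≤a → sum-zero n (λ b _ → ifEq-no _ (λ eq → ℕP.<⇒≱ (factor<ˡ a b eq) n≤a))))

⋆-as-grid : ∀ f g n N → n ≤ N → (f ⋆ g) n ≡ Grid N n (λ a b → f (suc a) * g (suc b))
⋆-as-grid f g n N n≤N = trans (sum-cong n row) (sym (Grid-pad n _ n≤N))
  where
  -- the divisor a+1 of n pairs with exactly one cofactor b+1
  row : ∀ a → a < n → guard (does (suc a ∣? n)) (f (suc a) * g (n ℕ./ suc a))
                    ≡ sumBelow n (λ b → ifEq (suc a *ℕ suc b) n (f (suc a) * g (suc b)))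
  row a a<n with suc a ∣? n
  ... | no a+1∤n = trans (guard-no (suc a ∣? n) _ a+1∤n) (sym (sum-zero n (λ b _ → ifEq-no _ (λ eq →
                     a+1∤n (divides (suc b) (trans (sym eq) (ℕP.*-comm (suc a) (suc b))))))))
  ... | yes (divides zero    n≡0) = ⊥-elim (ℕP.n≮0 (subst (a <_) n≡0 a<n))
  ... | yes a+1∣n@(divides (suc k) n≡k+1*a+1) =
    trans (guard-yes (suc a ∣? n) _ a+1∣n)
          (sym (trans (sum-single n k k<n others)
                      (trans (ifEq-yes _ (trans (ℕP.*-comm (suc a) (suc k)) (sym n≡k+1*a+1)))
                             (cong (λ m → f (suc a) * g m) (sym cofactor)))))
    where
    cofactor : n ℕ./ suc a ≡ suc k
    cofactor = trans (cong (ℕ._/ suc a) n≡k+1*a+1) (m*n/n≡m (suc k) (suc a))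
    k<n : k < n
    k<n = factor<ʳ a k (trans (ℕP.*-comm (suc a) (suc k)) (sym n≡k+1*a+1))
    others : ∀ b → b < n → b ≢ k → ifEq (suc a *ℕ suc b) n (f (suc a) * g (suc b)) ≡ 0ℤ
    others b _ b≢k = ifEq-no _ (λ eq → b≢k (ℕP.suc-injective
      (ℕP.*-cancelˡ-≡ (suc b) (suc k) (suc a) (trans eq (trans n≡k+1*a+1 (ℕP.*-comm (suc k) (suc a)))))))

-- Commutativity: transpose the grid of factorisations.
⋆-comm-at : ∀ f g n → (f ⋆ g) n ≡ (g ⋆ f) n
⋆-comm-at f g n =
  trans (⋆-as-grid f g n n ℕP.≤-refl)
        (trans (sum-swap n n _)
               (trans (sum-cong n (λ b _ → sum-cong n (λ a _ →
                         cong₂ (λ m x → ifEq m n x) (ℕP.*-comm (suc a) (suc b)) (ℤP.*-comm (f (suc a)) (g (suc b))))))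
                      (sym (⋆-as-grid g f n n ℕP.≤-refl))))

guard-Grid-*ʳ : ∀ b z N m t →
  guard b (Grid N m t * z) ≡ sumBelow N (λ a → sumBelow N (λ a' → guard b (ifEq (suc a *ℕ suc a') m (t a a' * z))))
guard-Grid-*ʳ b z N m t =
  trans (cong (guard b) (trans (sum-*ʳ N z _) (sum-cong N (λ a _ → trans (sum-*ʳ N z _)
          (sum-cong N (λ a' _ → guard-*ʳ (does (suc a *ℕ suc a' ℕ.≟ m)) z (t a a')))))))
        (trans (guard-sum b N _) (sum-cong N (λ a _ → guard-sum b N _)))

collapse : ∀ n k M F →
  sumBelow n (λ x → ifEq (suc x *ℕ suc M) n (ifEq (suc k) (suc x) F)) ≡ ifEq (suc k *ℕ suc M) n F
collapse n k M F with k ℕ.<? n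
... | yes k<n = trans (sum-single n k k<n others) (cong (ifEq (suc k *ℕ suc M) n) (ifEq-yes {suc k} F refl))
  where
  others : ∀ x → x < n → x ≢ k → ifEq (suc x *ℕ suc M) n (ifEq (suc k) (suc x) F) ≡ 0ℤ
  others x _ x≢k = trans (cong (ifEq (suc x *ℕ suc M) n) (ifEq-no F (λ eq → x≢k (sym (ℕP.suc-injective eq)))))
                         (ifEq-0 (suc x *ℕ suc M) n)
... | no k≮n = trans (sum-zero n vanish) (sym (ifEq-no F (λ eq → k≮n (factor<ˡ k M eq))))
  where
  vanish : ∀ x → x < n → ifEq (suc x *ℕ suc M) n (ifEq (suc k) (suc x) F) ≡ 0ℤ
  vanish x x<n = trans (cong (ifEq (suc x *ℕ suc M) n)
                             (ifEq-no F (λ eq → k≮n (subst (_< n) (sym (ℕP.suc-injective eq)) x<n))))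
                       (ifEq-0 (suc x *ℕ suc M) n)

sum-reorder4 : ∀ n (t : ℕ → ℕ → ℕ → ℕ → ℤ) →
  sumBelow n (λ i → sumBelow n (λ j → sumBelow n (λ k → sumBelow n (λ l → t i j k l))))
  ≡ sumBelow n (λ k → sumBelow n (λ l → sumBelow n (λ j → sumBelow n (λ i → t i j k l))))
sum-reorder4 n t =
  trans (sum-cong n (λ i _ → trans (sum-swap n n (λ j k → sumBelow n (t i j k)))
                                   (sum-cong n (λ k _ → sum-swap n n (λ j l → t i j k l)))))
 (trans (sum-swap n n (λ i k → sumBelow n (λ l → sumBelow n (λ j → t i j k l))))
        (sum-cong n (λ k _ → trans (sum-swap n n (λ i l → sumBelow n (λ j → t i j k l)))
                                   (sum-cong n (λ l _ → sum-swap n n (λ i j → t i j k l))))))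

Triple : ℕ → (ℕ → ℕ → ℕ → ℤ) → ℤ
Triple n t = sumBelow n (λ a → sumBelow n (λ b → sumBelow n (λ c → ifEq (suc a *ℕ suc b *ℕ suc c) n (t a b c))))

⋆-as-triple : ∀ f g h n → ((f ⋆ g) ⋆ h) n ≡ Triple n (λ a b c → f (suc a) * g (suc b) * h (suc c))
⋆-as-triple f g h n = begin
  ((f ⋆ g) ⋆ h) n
    ≡⟨ ⋆-as-grid (f ⋆ g) h n n ℕP.≤-refl ⟩
  sumBelow n (λ x → sumBelow n (λ c → ifEq (suc x *ℕ suc c) n ((f ⋆ g) (suc x) * h (suc c))))
    ≡⟨ sum-cong n (λ x _ → sum-cong n (λ c _ → expand x c)) ⟩
  sumBelow n (λ x → sumBelow n (λ c → sumBelow n (λ a → sumBelow n (λ b → T x c a b))))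
    ≡⟨ sum-reorder4 n T ⟩
  sumBelow n (λ a → sumBelow n (λ b → sumBelow n (λ c → sumBelow n (λ x → T x c a b))))
    ≡⟨ sum-cong n (λ a _ → sum-cong n (λ b _ → sum-cong n (λ c _ →
         collapse n (b +ℕ a *ℕ suc b) c (f (suc a) * g (suc b) * h (suc c))))) ⟩
  Triple n (λ a b c → f (suc a) * g (suc b) * h (suc c)) ∎
  where
  open ≡-Reasoning
  T : ℕ → ℕ → ℕ → ℕ → ℤ
  T x c a b = ifEq (suc x *ℕ suc c) n (ifEq (suc a *ℕ suc b) (suc x) (f (suc a) * g (suc b) * h (suc c)))
  -- under the guard, x+1 ≤ n bounds the inner factorisation of (f ⋆ g)(x+1)
  expand : ∀ x c → ifEq (suc x *ℕ suc c) n ((f ⋆ g) (suc x) * h (suc c))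
                   ≡ sumBelow n (λ a → sumBelow n (λ b → T x c a b))
  expand x c =
    trans (ifEq-cong (suc x *ℕ suc c) n (λ eq →
             cong (_* h (suc c)) (⋆-as-grid f g (suc x) n (factor<ˡ x c eq))))
          (guard-Grid-*ʳ (does (suc x *ℕ suc c ℕ.≟ n)) (h (suc c)) n (suc x) (λ a b → f (suc a) * g (suc b)))

-- Associativity: both bracketings are sums over the factorisations into three factors
-- (the right one after commuting the outer product).
⋆-assoc-at : ∀ f g h n → ((f ⋆ g) ⋆ h) n ≡ (f ⋆ (g ⋆ h)) n
⋆-assoc-at f g h n = begin
  ((f ⋆ g) ⋆ h) n
    ≡⟨ ⋆-as-triple f g h n ⟩
  sumBelow n (λ a → sumBelow n (λ b → sumBelow n (λ c → φ a b c)))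
    ≡⟨ sum-swap n n (λ a b → sumBelow n (φ a b)) ⟩
  sumBelow n (λ b → sumBelow n (λ a → sumBelow n (λ c → φ a b c)))
    ≡⟨ sum-cong n (λ b _ → sum-swap n n (λ a c → φ a b c)) ⟩
  sumBelow n (λ b → sumBelow n (λ c → sumBelow n (λ a → φ a b c)))
    ≡⟨ sum-cong n (λ b _ → sum-cong n (λ c _ → sum-cong n (λ a _ →
         cong₂ (λ m x → ifEq m n x) (rotateℕ (suc a) (suc b) (suc c)) (rotateℤ (f (suc a)) (g (suc b)) (h (suc c)))))) ⟩
  Triple n (λ b c a → g (suc b) * h (suc c) * f (suc a))
    ≡⟨ sym (⋆-as-triple g h f n) ⟩
  ((g ⋆ h) ⋆ f) n
    ≡⟨ ⋆-comm-at (g ⋆ h) f n ⟩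
  (f ⋆ (g ⋆ h)) n ∎
  where
  open ≡-Reasoning
  φ : ℕ → ℕ → ℕ → ℤ
  φ a b c = ifEq (suc a *ℕ suc b *ℕ suc c) n (f (suc a) * g (suc b) * h (suc c))
  rotateℕ : ∀ x y z → x *ℕ y *ℕ z ≡ y *ℕ z *ℕ x
  rotateℕ x y z = trans (ℕP.*-assoc x y z) (ℕP.*-comm x (y *ℕ z))
  rotateℤ : ∀ x y z → x * y * z ≡ y * z * x
  rotateℤ x y z = trans (ℤP.*-assoc x y z) (ℤP.*-comm x (y * z))

infix 4 _≐_
-- Equality of arithmetic functions: agreement at every n ≥ 1 (the value at 0 is meaningless).
record _≐_ (f g : ArithFun) : Set where
  constructor pointwise
  field at : ∀ n → 1 ≤ n → f n ≡ g n
open _≐_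

≐-setoid : Setoid _ _
≐-setoid = record
  { Carrier       = ArithFun
  ; _≈_           = _≐_
  ; isEquivalence = record
    { refl  = pointwise (λ _ _ → refl)
    ; sym   = λ f≐g → pointwise (λ n 1≤n → sym (at f≐g n 1≤n))
    ; trans = λ f≐g g≐h → pointwise (λ n 1≤n → trans (at f≐g n 1≤n) (at g≐h n 1≤n))
    }
  }

open Setoid ≐-setoid using () renaming (refl to ≐-refl; reflexive to ≐-reflexive; sym to ≐-sym; trans to ≐-trans)
module ≐-Reasoning = SetoidReasoning ≐-setoid

⋆-comm : ∀ f g → f ⋆ g ≐ g ⋆ f
⋆-comm f g = pointwise (λ n _ → ⋆-comm-at f g n)

⋆-assoc : ∀ f g h → (f ⋆ g) ⋆ h ≐ f ⋆ (g ⋆ h)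
⋆-assoc f g h = pointwise (λ n _ → ⋆-assoc-at f g h n)

⋆-identityˡ : ∀ f → e ⋆ f ≐ f
⋆-identityˡ f = pointwise (⋆-identityˡ-at f)

⋆-identityʳ : ∀ f → f ⋆ e ≐ f
⋆-identityʳ f = ≐-trans (⋆-comm f e) (⋆-identityˡ f)

-- Convolution respects ≐, since only values at n ≥ 1 enter into it.
⋆-cong : ∀ {f f' g g'} → f ≐ f' → g ≐ g' → f ⋆ g ≐ f' ⋆ g'
⋆-cong {f} {f'} {g} {g'} f≐f' g≐g' = pointwise λ n _ →
  trans (⋆-congˡ-upTo {f} {f'} g n (λ m 1≤m _ → at f≐f' m 1≤m))
        (trans (⋆-comm-at f' g n)
               (trans (⋆-congˡ-upTo {g} {g'} f' n (λ m 1≤m _ → at g≐g' m 1≤m)) (⋆-comm-at g' f' n)))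

⋆-congˡ : ∀ {f f'} g → f ≐ f' → f ⋆ g ≐ f' ⋆ g
⋆-congˡ {f} {f'} g f≐f' = ⋆-cong {f} {f'} {g} {g} f≐f' ≐-refl

⋆-congʳ : ∀ f {g g'} → g ≐ g' → f ⋆ g ≐ f ⋆ g'
⋆-congʳ f {g} {g'} g≐g' = ⋆-cong {f} {f} {g} {g'} ≐-refl g≐g'

countBelow : (ℕ → Bool) → ℕ → ℕ
countBelow b zero    = 0
countBelow b (suc N) = countBelow b N +ℕ (if b N then 1 else 0)

length-filter-upTo : ∀ {P : ℕ → Set} (P? : ∀ q → Dec (P q)) N →
                     length (filter P? (upTo N)) ≡ countBelow (λ q → does (P? q)) N
length-filter-upTo P? zero    = refl
length-filter-upTo P? (suc N) = begin
  length (filter P? (upTo (suc N)))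
    ≡⟨ cong (λ l → length (filter P? l)) (List.upTo-∷ʳ N) ⟨
  length (filter P? (upTo N ++ N ∷ []))
    ≡⟨ cong length (List.filter-++ P? (upTo N) (N ∷ [])) ⟩
  length (filter P? (upTo N) ++ filter P? (N ∷ []))
    ≡⟨ List.length-++ (filter P? (upTo N)) ⟩
  length (filter P? (upTo N)) +ℕ length (filter P? (N ∷ []))
    ≡⟨ cong₂ _+ℕ_ (length-filter-upTo P? N) last ⟩
  countBelow (λ q → does (P? q)) (suc N) ∎
  where
  open ≡-Reasoning
  last : length (filter P? (N ∷ [])) ≡ (if does (P? N) then 1 else 0)
  last with does (P? N)
  ... | true  = refl
  ... | false = refl

count-pad : ∀ b {N M} → N ≤ M → (∀ q → N ≤ q → b q ≡ false) → countBelow b M ≡ countBelow b N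
count-pad b {N} {zero}  z≤n    _ = refl
count-pad b {N} {suc M} N≤1+M h with ℕP.m≤n⇒m<n∨m≡n N≤1+M
... | inj₁ N≤M  rewrite count-pad b (ℕP.≤-pred N≤M) h | h M (ℕP.≤-pred N≤M) = ℕP.+-identityʳ _
... | inj₂ refl = refl

count-agree : ∀ b b' N → (∀ q → q < N → b' q ≡ b q) → countBelow b' N ≡ countBelow b N
count-agree b b' zero    h = refl
count-agree b b' (suc N) h rewrite count-agree b b' N (λ q q<N → h q (ℕP.m<n⇒m<1+n q<N)) | h N ℕP.≤-refl = refl

count-insert : ∀ b b' p N → (∀ q → q ≢ p → b' q ≡ b q) → b' p ≡ true → b p ≡ false → p < N →
               countBelow b' N ≡ suc (countBelow b N)
count-insert b b' p (suc N) h b'p bp p<1+N with ℕP.m<1+n⇒m<n∨m≡n p<1+N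
... | inj₁ p<N  rewrite count-insert b b' p N h b'p bp p<N | h N (λ N≡p → ℕP.<⇒≢ p<N (sym N≡p)) = refl
... | inj₂ refl rewrite count-agree b b' p (λ q q<p → h q (ℕP.<⇒≢ q<p)) | b'p | bp =
  trans (ℕP.+-comm (countBelow b p) 1) (cong suc (sym (ℕP.+-identityʳ (countBelow b p))))

primeFactor : ∀ n → 2 ≤ n → ∃ λ p → Prime p × p ∣ n
primeFactor n 2≤n with factorise n {{ℕ.>-nonZero (ℕP.<-trans (s≤s z≤n) 2≤n)}}
... | record { factors = [] ; isFactorisation = n≡1 } = ⊥-elim (ℕP.<⇒≢ 2≤n (sym n≡1))
... | record { factors = p ∷ ps ; isFactorisation = n≡p*ps ; factorsPrime = p-prime ∷ _ } =
  p , p-prime , subst (p ∣_) (sym n≡p*ps) (m∣m*n (product ps))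

-- Towards the two facts about μ that Möbius inversion needs: μ vanishes on non-squarefree
-- numbers, and μ(pk) = -μ(k) for a prime p ∤ k.
primeDivisorOf : ℕ → ℕ → Bool
primeDivisorOf x q = does (prime? q ×-dec (q ∣? x))

ω-as-count : ∀ x → ω x ≡ countBelow (primeDivisorOf x) (suc x)
ω-as-count x = length-filter-upTo (λ q → prime? q ×-dec (q ∣? x)) (suc x)

squareDivisor? : ∀ x → Dec (Any (λ m → 2 ≤ m × m *ℕ m ∣ x) (upTo (suc x)))
squareDivisor? x = any? (λ m → (2 ℕ.≤? m) ×-dec (m *ℕ m ∣? x)) (upTo (suc x))

-- a square divisor m² of x ≥ 1 has m ≤ x, so the search in the definition of μ finds it
squareDivisor-found : ∀ x m → 1 ≤ x → 2 ≤ m → m *ℕ m ∣ x → Any (λ m → 2 ≤ m × m *ℕ m ∣ x) (upTo (suc x))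
squareDivisor-found x m 1≤x 2≤m m²∣x = Any.applyUpTo⁺ (λ i → i) (2≤m , m²∣x) (s≤s m≤x)
  where m≤x : m ≤ x
        m≤x = ℕP.≤-trans (ℕP.m≤m*n m m {{ℕ.>-nonZero (ℕP.<-trans (s≤s z≤n) 2≤m)}}) (∣⇒≤ {{ℕ.>-nonZero 1≤x}} m²∣x)

μ-square : ∀ x m → 1 ≤ x → 2 ≤ m → m *ℕ m ∣ x → μ x ≡ 0ℤ
μ-square x m 1≤x 2≤m m²∣x =
  cong (λ b → if b then 0ℤ else negOnePow (ω x)) (dec-true (squareDivisor? x) (squareDivisor-found x m 1≤x 2≤m m²∣x))

μ-squarefree : ∀ x → (∀ m → 2 ≤ m → ¬ m *ℕ m ∣ x) → μ x ≡ negOnePow (ω x)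
μ-squarefree x squarefree = cong (λ b → if b then 0ℤ else negOnePow (ω x)) (dec-false (squareDivisor? x) none)
  where none : ¬ Any (λ m → 2 ≤ m × m *ℕ m ∣ x) (upTo (suc x))
        none found with Any.applyUpTo⁻ (λ i → i) found
        ... | m , _ , 2≤m , m²∣x = squarefree m 2≤m m²∣x

module _ {p k : ℕ} (p-prime : Prime p) (p∤k : ¬ p ∣ k) (1≤k : 1 ≤ k) where

  private instance
    k≢0 : NonZero k
    k≢0 = ℕ.>-nonZero 1≤k
    p≢0 : NonZero p
    p≢0 = prime⇒nonZero p-prime

  primeDivisor-other : ∀ q → q ≢ p → primeDivisorOf (p *ℕ k) q ≡ primeDivisorOf k q
  primeDivisor-other q q≢p = does-⇔ (mk⇔
    (λ (q-prime , q∣pk) → q-prime , [ q∣p⇒q∣k q-prime , (λ q∣k → q∣k) ] (euclidsLemma p k q-prime q∣pk))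
    (λ (q-prime , q∣k) → q-prime , ∣n⇒∣m*n p q∣k))
    (prime? q ×-dec (q ∣? (p *ℕ k))) (prime? q ×-dec (q ∣? k))
    where
    q∣p⇒q∣k : Prime q → q ∣ p → q ∣ k
    q∣p⇒q∣k q-prime q∣p with prime⇒irreducible p-prime q∣p
    ... | inj₁ refl = ⊥-elim (¬prime[1] q-prime)
    ... | inj₂ q≡p  = ⊥-elim (q≢p q≡p)

  ω-prime-mul : ω (p *ℕ k) ≡ suc (ω k)
  ω-prime-mul = begin
    ω (p *ℕ k)
      ≡⟨ ω-as-count (p *ℕ k) ⟩
    countBelow (primeDivisorOf (p *ℕ k)) (suc (p *ℕ k))
      ≡⟨ count-insert (primeDivisorOf k) _ p _ primeDivisor-other
           (dec-true (prime? p ×-dec (p ∣? (p *ℕ k))) (p-prime , m∣m*n k))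
           (dec-false (prime? p ×-dec (p ∣? k)) (λ (_ , p∣k) → p∤k p∣k))
           (s≤s (ℕP.m≤m*n p k)) ⟩
    suc (countBelow (primeDivisorOf k) (suc (p *ℕ k)))
      ≡⟨ cong suc (count-pad (primeDivisorOf k) (s≤s (ℕP.m≤n*m k p)) beyond) ⟩
    suc (countBelow (primeDivisorOf k) (suc k))
      ≡⟨ cong suc (ω-as-count k) ⟨
    suc (ω k) ∎
    where
    open ≡-Reasoning
    beyond : ∀ q → suc k ≤ q → primeDivisorOf k q ≡ false
    beyond q k<q = dec-false (prime? q ×-dec (q ∣? k)) (λ (_ , q∣k) → ℕP.<⇒≱ k<q (∣⇒≤ q∣k))

  square-prime-mul : ∀ m → m *ℕ m ∣ p *ℕ k → m *ℕ m ∣ k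
  square-prime-mul m m²∣pk with p ∣? m
  ... | yes p∣m = ⊥-elim (p∤k (*-cancelˡ-∣ p (∣-trans (*-pres-∣ p∣m p∣m) m²∣pk)))
  ... | no  p∤m = coprime-divisor m²⊥p m²∣pk
    where
    m²⊥p : Coprime (m *ℕ m) p
    m²⊥p (d∣m² , d∣p) with prime⇒irreducible p-prime d∣p
    ... | inj₁ d≡1 = d≡1
    ... | inj₂ refl = ⊥-elim ([ p∤m , p∤m ] (euclidsLemma m m p-prime d∣m²))

  -- μ(pk) = -μ(k): pk is squarefree iff k is, and has one more prime divisor.
  μ-prime-mul : μ (p *ℕ k) ≡ - μ k
  μ-prime-mul with squareDivisor? k
  ... | yes found with Any.applyUpTo⁻ (λ i → i) found
  ...   | m , _ , 2≤m , m²∣k = trans (μ-square (p *ℕ k) m (ℕP.≤-trans 1≤k (ℕP.m≤n*m k p)) 2≤m (∣n⇒∣m*n p m²∣k))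
                                     (sym (cong -_ (μ-square k m 1≤k 2≤m m²∣k)))
  μ-prime-mul | no none =
    trans (μ-squarefree (p *ℕ k) (λ m 2≤m m²∣pk → k-squarefree m 2≤m (square-prime-mul m m²∣pk)))
          (trans (cong negOnePow ω-prime-mul) (cong -_ (sym (μ-squarefree k k-squarefree))))
    where k-squarefree : ∀ m → 2 ≤ m → ¬ m *ℕ m ∣ k
          k-squarefree m 2≤m m²∣k = none (squareDivisor-found k m 1≤k 2≤m m²∣k)

-- μ(pk) = 0 when p ∣ k, as p² ∣ pk.
μ-prime-mul-divisible : ∀ {p k} → Prime p → p ∣ k → 1 ≤ k → μ (p *ℕ k) ≡ 0ℤ
μ-prime-mul-divisible {p} {k} p-prime p∣k 1≤k =
  μ-square (p *ℕ k) p (ℕP.≤-trans 1≤k (ℕP.m≤n*m k p {{prime⇒nonZero p-prime}}))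
           (ℕ.nonTrivial⇒n>1 p {{prime⇒nonTrivial p-prime}}) (*-pres-∣ (∣-refl {p}) p∣k)

sum-multiples : ∀ p m .{{_ : NonZero p}} (F : ℕ → ℤ) →
  sumBelow (m *ℕ p) (λ i → guard (does (p ∣? suc i)) (F (suc i))) ≡ sumBelow m (λ k → F (p *ℕ suc k))
sum-multiples p m F =
  trans (sum-cong (m *ℕ p) spread)
        (trans (sum-swap (m *ℕ p) m (λ i k → ifEq (p *ℕ suc k) (suc i) (F (p *ℕ suc k)))) (sum-cong m pick))
  where
  -- a multiple i+1 of p below mp is p(k+1) for exactly one k < m
  spread : ∀ i → i < m *ℕ p →
           guard (does (p ∣? suc i)) (F (suc i)) ≡ sumBelow m (λ k → ifEq (p *ℕ suc k) (suc i) (F (p *ℕ suc k)))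
  spread i i<mp with p ∣? suc i
  ... | no p∤i+1 = sym (sum-zero m (λ k _ → ifEq-no _ (λ eq →
                     p∤i+1 (divides (suc k) (trans (sym eq) (ℕP.*-comm p (suc k)))))))
  ... | yes (divides zero i+1≡0) = ⊥-elim (ℕP.1+n≢0 i+1≡0)
  ... | yes (divides (suc k₀) i+1≡k₀+1*p) =
    sym (trans (sum-single m k₀ k₀<m others) (trans (ifEq-yes _ p[k₀+1]≡i+1) (cong F p[k₀+1]≡i+1)))
    where
    p[k₀+1]≡i+1 : p *ℕ suc k₀ ≡ suc i
    p[k₀+1]≡i+1 = trans (ℕP.*-comm p (suc k₀)) (sym i+1≡k₀+1*p)
    k₀<m : k₀ < m
    k₀<m = ℕP.*-cancelʳ-≤ (suc k₀) m p (subst (_≤ m *ℕ p) i+1≡k₀+1*p i<mp)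
    others : ∀ k → k < m → k ≢ k₀ → ifEq (p *ℕ suc k) (suc i) (F (p *ℕ suc k)) ≡ 0ℤ
    others k _ k≢k₀ = ifEq-no _ (λ eq → k≢k₀ (ℕP.suc-injective (ℕP.*-cancelˡ-≡ (suc k) (suc k₀) p
                                                                (trans eq (sym p[k₀+1]≡i+1)))))
  pick : ∀ k → k < m → sumBelow (m *ℕ p) (λ i → ifEq (p *ℕ suc k) (suc i) (F (p *ℕ suc k))) ≡ F (p *ℕ suc k)
  pick k k<m = trans (sum-single (m *ℕ p) j j<mp others) (ifEq-yes _ (sym j+1≡p[k+1]))
    where
    instance p[k+1]≢0 : NonZero (p *ℕ suc k)
    p[k+1]≢0 = ℕP.m*n≢0 p (suc k)
    j : ℕ
    j = ℕ.pred (p *ℕ suc k)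
    j+1≡p[k+1] : suc j ≡ p *ℕ suc k
    j+1≡p[k+1] = ℕP.suc-pred (p *ℕ suc k)
    j<mp : j < m *ℕ p
    j<mp = subst (_≤ m *ℕ p) (sym j+1≡p[k+1]) (subst (p *ℕ suc k ≤_) (ℕP.*-comm p m) (ℕP.*-monoʳ-≤ p k<m))
    others : ∀ i → i < m *ℕ p → i ≢ j → ifEq (p *ℕ suc k) (suc i) (F (p *ℕ suc k)) ≡ 0ℤ
    others i _ i≢j = ifEq-no _ (λ eq → i≢j (ℕP.suc-injective (trans (sym eq) (sym j+1≡p[k+1]))))

-- Möbius inversion at n = mp (p prime, m ≥ 1): the divisors of n prime to p are the divisors
-- of m prime to p, while those divisible by p are the pd with d ∣ m; as μ(pd) = -μ(d) when
-- p ∤ d and μ(pd) = 0 otherwise, the two parts cancel.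
module _ {p m : ℕ} (p-prime : Prime p) (1≤m : 1 ≤ m) where

  private instance
    p≢0 : NonZero p
    p≢0 = prime⇒nonZero p-prime

  coprimeTerm : ℕ → ℕ → ℤ
  coprimeTerm N i = guard (does (suc i ∣? N)) (guard (not (does (p ∣? suc i))) (μ (suc i)))

  multipleTerm : ℕ → ℕ → ℤ
  multipleTerm N i = guard (does (suc i ∣? N)) (guard (does (p ∣? suc i)) (μ (suc i)))

  coprime-divisor-of-m : ∀ d → ¬ p ∣ d → d ∣ m *ℕ p → d ∣ m
  coprime-divisor-of-m d p∤d d∣mp = coprime-divisor d⊥p (subst (d ∣_) (ℕP.*-comm m p) d∣mp)
    where d⊥p : Coprime d p
          d⊥p (c∣d , c∣p) with prime⇒irreducible p-prime c∣p
          ... | inj₁ c≡1 = c≡1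
          ... | inj₂ refl = ⊥-elim (p∤d c∣d)

  coprime-sum : sumBelow (m *ℕ p) (coprimeTerm (m *ℕ p)) ≡ sumBelow m (coprimeTerm m)
  coprime-sum = trans (sum-cong (m *ℕ p) (λ i _ → same-divisors i))
                      (sum-pad (coprimeTerm m) (ℕP.m≤m*n m p) beyond)
    where
    same-divisors : ∀ i → coprimeTerm (m *ℕ p) i ≡ coprimeTerm m i
    same-divisors i with p ∣? suc i
    ... | yes _   = trans (guard-0 (does (suc i ∣? m *ℕ p))) (sym (guard-0 (does (suc i ∣? m))))
    ... | no p∤i+1 = cong (λ b → guard b (μ (suc i)))
                          (does-⇔ (mk⇔ (coprime-divisor-of-m (suc i) p∤i+1) (∣m⇒∣m*n p)) (suc i ∣? m *ℕ p) (suc i ∣? m))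
    beyond : ∀ i → m ≤ i → coprimeTerm m i ≡ 0ℤ
    beyond i m≤i = guard-no (suc i ∣? m) _ (λ i+1∣m → ℕP.<⇒≱ (s≤s m≤i) (∣⇒≤ {{ℕ.>-nonZero 1≤m}} i+1∣m))

  -- the divisors p(k+1) of mp, with k+1 ∣ m, contribute μ(p(k+1)) = -[p ∤ k+1] μ(k+1)
  multiple-sum : sumBelow (m *ℕ p) (multipleTerm (m *ℕ p)) ≡ - sumBelow m (coprimeTerm m)
  multiple-sum =
    trans (sum-cong (m *ℕ p) (λ i _ → guard-swap (does (suc i ∣? m *ℕ p)) (does (p ∣? suc i)) (μ (suc i))))
   (trans (sum-multiples p m (λ d → guard (does (d ∣? m *ℕ p)) (μ d)))
   (trans (sum-cong m (λ k _ → negate k)) (sym (sum-neg m (coprimeTerm m)))))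
    where
    negate : ∀ k → guard (does (p *ℕ suc k ∣? m *ℕ p)) (μ (p *ℕ suc k)) ≡ - coprimeTerm m k
    negate k with p ∣? suc k
    ... | yes p∣k+1 = trans (cong (guard (does (p *ℕ suc k ∣? m *ℕ p))) (μ-prime-mul-divisible p-prime p∣k+1 (s≤s z≤n)))
                            (trans (guard-0 (does (p *ℕ suc k ∣? m *ℕ p))) (cong -_ (sym (guard-0 (does (suc k ∣? m))))))
    ... | no  p∤k+1 = trans (cong₂ guard (does-⇔ (mk⇔ cancel extend) (p *ℕ suc k ∣? m *ℕ p) (suc k ∣? m))
                                         (μ-prime-mul p-prime p∤k+1 (s≤s z≤n)))
                            (guard-neg (does (suc k ∣? m)) (μ (suc k)))
      where
      cancel : p *ℕ suc k ∣ m *ℕ p → suc k ∣ m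
      cancel d = *-cancelˡ-∣ p (subst (p *ℕ suc k ∣_) (ℕP.*-comm m p) d)
      extend : suc k ∣ m → p *ℕ suc k ∣ m *ℕ p
      extend k+1∣m = subst (p *ℕ suc k ∣_) (ℕP.*-comm p m) (*-monoʳ-∣ p k+1∣m)

  möbius-at-multiple : (μ ⋆ one) (m *ℕ p) ≡ 0ℤ
  möbius-at-multiple =
    trans (sum-cong (m *ℕ p) (λ i _ → guard-split (does (suc i ∣? m *ℕ p)) (does (p ∣? suc i)) (μ (suc i))))
   (trans (sum-+ (m *ℕ p) (coprimeTerm (m *ℕ p)) (multipleTerm (m *ℕ p)))
   (trans (cong₂ _+_ coprime-sum multiple-sum) (ℤP.+-inverseʳ (sumBelow m (coprimeTerm m)))))

möbius : μ ⋆ one ≐ e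
möbius = pointwise at-n
  where
  at-n : ∀ n → 1 ≤ n → (μ ⋆ one) n ≡ e n
  at-n 1 _ = refl
  at-n n@(suc (suc _)) _ with primeFactor n (s≤s (s≤s z≤n))
  ... | p , p-prime , divides zero    n≡0   = ⊥-elim (ℕP.1+n≢0 n≡0)
  ... | p , p-prime , divides (suc m) n≡m*p =
    trans (cong (μ ⋆ one) n≡m*p) (möbius-at-multiple {p} {suc m} p-prime (s≤s z≤n))

⋆-interchange : ∀ a b c d → (a ⋆ b) ⋆ (c ⋆ d) ≐ (a ⋆ c) ⋆ (b ⋆ d)
⋆-interchange a b c d = begin
  (a ⋆ b) ⋆ (c ⋆ d) ≈⟨ ⋆-assoc a b (c ⋆ d) ⟩
  a ⋆ (b ⋆ (c ⋆ d)) ≈⟨ ⋆-congʳ a (⋆-assoc b c d) ⟨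
  a ⋆ ((b ⋆ c) ⋆ d) ≈⟨ ⋆-congʳ a (⋆-congˡ d (⋆-comm b c)) ⟩
  a ⋆ ((c ⋆ b) ⋆ d) ≈⟨ ⋆-congʳ a (⋆-assoc c b d) ⟩
  a ⋆ (c ⋆ (b ⋆ d)) ≈⟨ ⋆-assoc a c (b ⋆ d) ⟨
  (a ⋆ c) ⋆ (b ⋆ d) ∎
  where open ≐-Reasoning

^⋆-cong : ∀ {f f'} k → f ≐ f' → f ^⋆ k ≐ f' ^⋆ k
^⋆-cong zero    f≐f' = ≐-refl
^⋆-cong (suc k) f≐f' = ⋆-cong f≐f' (^⋆-cong k f≐f')

^⋆-+ : ∀ f a b → f ^⋆ (a +ℕ b) ≐ (f ^⋆ a) ⋆ (f ^⋆ b)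
^⋆-+ f zero    b = ≐-sym (⋆-identityˡ (f ^⋆ b))
^⋆-+ f (suc a) b = ≐-trans (⋆-congʳ f (^⋆-+ f a b)) (≐-sym (⋆-assoc f (f ^⋆ a) (f ^⋆ b)))

^⋆-distrib-⋆ : ∀ f g k → (f ⋆ g) ^⋆ k ≐ (f ^⋆ k) ⋆ (g ^⋆ k)
^⋆-distrib-⋆ f g zero    = ≐-sym (⋆-identityˡ e)
^⋆-distrib-⋆ f g (suc k) = ≐-trans (⋆-congʳ (f ⋆ g) (^⋆-distrib-⋆ f g k)) (⋆-interchange f g (f ^⋆ k) (g ^⋆ k))

e-^⋆ : ∀ k → e ^⋆ k ≐ e
e-^⋆ zero    = ≐-refl
e-^⋆ (suc k) = ≐-trans (⋆-congʳ e (e-^⋆ k)) (⋆-identityˡ e)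

one^⋆-μ^⋆ : ∀ t → (one ^⋆ t) ⋆ (μ ^⋆ t) ≐ e
one^⋆-μ^⋆ t = begin
  (one ^⋆ t) ⋆ (μ ^⋆ t) ≈⟨ ^⋆-distrib-⋆ one μ t ⟨
  (one ⋆ μ) ^⋆ t        ≈⟨ ^⋆-cong t (≐-trans (⋆-comm one μ) möbius) ⟩
  e ^⋆ t                ≈⟨ e-^⋆ t ⟩
  e                     ∎
  where open ≐-Reasoning

one^⋆-μ^⋆-cancel : ∀ a b t → (one ^⋆ (a +ℕ t)) ⋆ (μ ^⋆ (b +ℕ t)) ≐ (one ^⋆ a) ⋆ (μ ^⋆ b)
one^⋆-μ^⋆-cancel a b t = begin
  (one ^⋆ (a +ℕ t)) ⋆ (μ ^⋆ (b +ℕ t))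
    ≈⟨ ⋆-cong (^⋆-+ one a t) (^⋆-+ μ b t) ⟩
  ((one ^⋆ a) ⋆ (one ^⋆ t)) ⋆ ((μ ^⋆ b) ⋆ (μ ^⋆ t))
    ≈⟨ ⋆-interchange (one ^⋆ a) (one ^⋆ t) (μ ^⋆ b) (μ ^⋆ t) ⟩
  ((one ^⋆ a) ⋆ (μ ^⋆ b)) ⋆ ((one ^⋆ t) ⋆ (μ ^⋆ t))
    ≈⟨ ⋆-congʳ ((one ^⋆ a) ⋆ (μ ^⋆ b)) (one^⋆-μ^⋆ t) ⟩
  ((one ^⋆ a) ⋆ (μ ^⋆ b)) ⋆ e
    ≈⟨ ⋆-identityʳ ((one ^⋆ a) ⋆ (μ ^⋆ b)) ⟩
  (one ^⋆ a) ⋆ (μ ^⋆ b) ∎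
  where open ≐-Reasoning

pos-difference : ∀ a b p → + a - + b ≡ + p → a ≡ p +ℕ b
pos-difference a b p a-b≡p =
  ℤP.+-injective (trans (add-back (+ a) (+ b)) (trans (cong (_+ + b) a-b≡p) (sym (ℤP.pos-+ p b))))
  where add-back : ∀ x y → x ≡ x - y + y
        add-back = solve-∀

negsuc-difference : ∀ a b q → + a - + b ≡ -[1+ q ] → b ≡ suc q +ℕ a
negsuc-difference a b q a-b≡-q-1 =
  ℤP.+-injective (trans (subtract-back (+ a) (+ b))
    (trans (cong (_-_ (+ a)) a-b≡-q-1) (trans (sym (ℤP.pos-+ a (suc q))) (cong +_ (ℕP.+-comm a (suc q))))))
  where subtract-back : ∀ x y → y ≡ x - (x - y)
        subtract-back = solve-∀

integer-as-difference : ∀ r → ∃₂ λ a b → + a - + b ≡ r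
integer-as-difference (+ p)    = p , 0 , ℤP.+-identityʳ (+ p)
integer-as-difference -[1+ q ] = 0 , suc q , refl

onePow-as-difference : ∀ r a b → + a - + b ≡ r → onePow r ≐ (one ^⋆ a) ⋆ (μ ^⋆ b)
onePow-as-difference (+ p) a b a-b≡p rewrite pos-difference a b p a-b≡p =
  ≐-sym (≐-trans (one^⋆-μ^⋆-cancel p 0 b) (⋆-identityʳ (one ^⋆ p)))
onePow-as-difference -[1+ q ] a b a-b≡-q-1 rewrite negsuc-difference a b q a-b≡-q-1 =
  ≐-sym (≐-trans (one^⋆-μ^⋆-cancel 0 (suc q) a) (⋆-identityˡ (μ ^⋆ suc q)))

-- The group law 1^{*r} ⋆ 1^{*s} = 1^{*(r+s)}, via r = a - b and s = c - d.
onePow-+ : ∀ r s → onePow r ⋆ onePow s ≐ onePow (r + s)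
onePow-+ r s with integer-as-difference r | integer-as-difference s
... | a , b , a-b≡r | c , d , c-d≡s = begin
  onePow r ⋆ onePow s
    ≈⟨ ⋆-cong (onePow-as-difference r a b a-b≡r) (onePow-as-difference s c d c-d≡s) ⟩
  ((one ^⋆ a) ⋆ (μ ^⋆ b)) ⋆ ((one ^⋆ c) ⋆ (μ ^⋆ d))
    ≈⟨ ⋆-interchange (one ^⋆ a) (μ ^⋆ b) (one ^⋆ c) (μ ^⋆ d) ⟩
  ((one ^⋆ a) ⋆ (one ^⋆ c)) ⋆ ((μ ^⋆ b) ⋆ (μ ^⋆ d))
    ≈⟨ ⋆-cong (^⋆-+ one a c) (^⋆-+ μ b d) ⟨
  (one ^⋆ (a +ℕ c)) ⋆ (μ ^⋆ (b +ℕ d))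
    ≈⟨ onePow-as-difference (r + s) (a +ℕ c) (b +ℕ d) sum-difference ⟨
  onePow (r + s) ∎
  where
  open ≐-Reasoning
  regroup : ∀ x y z w → (x + z) - (y + w) ≡ (x - y) + (z - w)
  regroup = solve-∀
  sum-difference : + (a +ℕ c) - + (b +ℕ d) ≡ r + s
  sum-difference = trans (cong₂ _-_ (ℤP.pos-+ a c) (ℤP.pos-+ b d))
                         (trans (regroup (+ a) (+ b) (+ c) (+ d)) (cong₂ _+_ a-b≡r c-d≡s))

*-/ℕ-cancel : ∀ y d .{{_ : NonZero d}} → (y * + d) /ℕ d ≡ y
*-/ℕ-cancel (+ k)    (suc d) = trans (cong (_/ℕ suc d) (sym (ℤP.pos-* k (suc d)))) (cong +_ (m*n/n≡m k (suc d)))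
*-/ℕ-cancel -[1+ k ] (suc d) with m*n%n≡0 (suc k) (suc d) | m*n/n≡m (suc k) (suc d)
... | remainder≡0 | quotient≡k+1 rewrite remainder≡0 | quotient≡k+1 = refl

falling-suc : ∀ x a → falling x (suc a) ≡ x * falling (x - 1ℤ) a
falling-suc x zero    = lemma x
  where lemma : ∀ x → 1ℤ * (x - 0ℤ) ≡ x * 1ℤ
        lemma = solve-∀
falling-suc x (suc a) = begin
  falling x (suc a) * (x - + suc a)          ≡⟨ cong₂ _*_ (falling-suc x a) (cong (_-_ x) (ℤP.pos-+ 1 a)) ⟩
  x * falling (x - 1ℤ) a * (x - (1ℤ + + a))  ≡⟨ regroup x (falling (x - 1ℤ) a) (+ a) ⟩
  x * (falling (x - 1ℤ) a * (x - 1ℤ - + a))  ∎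
  where
  open ≡-Reasoning
  regroup : ∀ x F a → x * F * (x - (1ℤ + a)) ≡ x * (F * (x - 1ℤ - a))
  regroup = solve-∀

falling-pascal : ∀ x a → falling x (suc a) ≡ falling (x - 1ℤ) (suc a) + + suc a * falling (x - 1ℤ) a
falling-pascal x a = begin
  falling x (suc a)
    ≡⟨ falling-suc x a ⟩
  x * falling (x - 1ℤ) a
    ≡⟨ split x (falling (x - 1ℤ) a) (+ a) ⟩
  falling (x - 1ℤ) a * (x - 1ℤ - + a) + (1ℤ + + a) * falling (x - 1ℤ) a
    ≡⟨ cong (λ z → falling (x - 1ℤ) (suc a) + z * falling (x - 1ℤ) a) (ℤP.pos-+ 1 a) ⟨
  falling (x - 1ℤ) (suc a) + + suc a * falling (x - 1ℤ) a ∎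
  where
  open ≡-Reasoning
  split : ∀ x F a → x * F ≡ F * (x - 1ℤ - a) + (1ℤ + a) * F
  split = solve-∀

pos-suc-1 : ∀ m → + suc m - 1ℤ ≡ + m
pos-suc-1 m = trans (cong (_- 1ℤ) (ℤP.pos-+ 1 m)) (cancel (+ m))
  where cancel : ∀ x → 1ℤ + x - 1ℤ ≡ x
        cancel = solve-∀

falling-pos : ∀ m a → falling (+ m) a ≡ + ((m C a) *ℕ a !)
falling-pos m       zero    = refl
falling-pos zero    (suc a) = trans (falling-suc (+ 0) a) (ℤP.*-zeroˡ (falling (+ 0 - 1ℤ) a))
falling-pos (suc m) (suc a) = begin
  falling (+ suc m) (suc a)
    ≡⟨ falling-pascal (+ suc m) a ⟩
  falling (+ suc m - 1ℤ) (suc a) + + suc a * falling (+ suc m - 1ℤ) a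
    ≡⟨ cong (λ z → falling z (suc a) + + suc a * falling z a) (pos-suc-1 m) ⟩
  falling (+ m) (suc a) + + suc a * falling (+ m) a
    ≡⟨ cong₂ (λ u v → u + + suc a * v) (falling-pos m (suc a)) (falling-pos m a) ⟩
  + ((m C suc a) *ℕ suc a !) + + suc a * + ((m C a) *ℕ a !)
    ≡⟨ cong (_+_ (+ ((m C suc a) *ℕ suc a !))) (ℤP.pos-* (suc a) ((m C a) *ℕ a !)) ⟨
  + ((m C suc a) *ℕ suc a !) + + (suc a *ℕ ((m C a) *ℕ a !))
    ≡⟨ ℤP.pos-+ ((m C suc a) *ℕ suc a !) (suc a *ℕ ((m C a) *ℕ a !)) ⟨
  + ((m C suc a) *ℕ suc a ! +ℕ suc a *ℕ ((m C a) *ℕ a !))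
    ≡⟨ cong +_ (collect (m C suc a) (m C a) (suc a) (a !)) ⟩
  + ((m C a +ℕ m C suc a) *ℕ suc a !)
    ≡⟨ cong (λ z → + (z *ℕ suc a !)) (nCk+nC[k+1]≡[n+1]C[k+1] m a) ⟩
  + ((suc m C suc a) *ℕ suc a !) ∎
  where
  open ≡-Reasoning
  collect : ∀ p q s f → p *ℕ (s *ℕ f) +ℕ s *ℕ (q *ℕ f) ≡ (q +ℕ p) *ℕ (s *ℕ f)
  collect = ℕ-Solver.solve-∀

falling-negsuc : ∀ m a → falling -[1+ m ] a ≡ negOnePow a * falling (+ (m +ℕ a)) a
falling-negsuc m zero    = refl
falling-negsuc m (suc a) = begin
  falling -[1+ m ] a * (-[1+ m ] - + a)
    ≡⟨ cong (_* (-[1+ m ] - + a)) (falling-negsuc m a) ⟩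
  negOnePow a * falling (+ (m +ℕ a)) a * (-[1+ m ] - + a)
    ≡⟨ cong₂ (λ u v → negOnePow a * falling u a * v) top-1 top ⟩
  negOnePow a * falling (M - 1ℤ) a * (- M)
    ≡⟨ regroup (negOnePow a) (falling (M - 1ℤ) a) M ⟩
  - negOnePow a * (M * falling (M - 1ℤ) a)
    ≡⟨ cong (- negOnePow a *_) (falling-suc M a) ⟨
  - negOnePow a * falling M (suc a) ∎
  where
  open ≡-Reasoning
  M : ℤ
  M = + (m +ℕ suc a)
  top-1 : + (m +ℕ a) ≡ M - 1ℤ
  top-1 = sym (trans (cong (λ z → + z - 1ℤ) (ℕP.+-suc m a)) (pos-suc-1 (m +ℕ a)))
  top : -[1+ m ] - + a ≡ - M
  top = trans (sym (ℤP.neg-distrib-+ (+ suc m) (+ a)))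
              (cong -_ (trans (sym (ℤP.pos-+ (suc m) a)) (cong +_ (sym (ℕP.+-suc m a)))))
  regroup : ∀ s F y → s * F * (- y) ≡ - s * (y * F)
  regroup = solve-∀

binomInt : ℤ → ℕ → ℤ
binomInt (+ m)    a = + (m C a)
binomInt -[1+ m ] a = negOnePow a * + ((m +ℕ a) C a)

falling≡binomInt*a! : ∀ x a → falling x a ≡ binomInt x a * + (a !)
falling≡binomInt*a! (+ m)    a = trans (falling-pos m a) (ℤP.pos-* (m C a) (a !))
falling≡binomInt*a! -[1+ m ] a =
  trans (falling-negsuc m a)
        (trans (cong (negOnePow a *_) (trans (falling-pos (m +ℕ a) a) (ℤP.pos-* ((m +ℕ a) C a) (a !))))
               (sym (ℤP.*-assoc (negOnePow a) (+ ((m +ℕ a) C a)) (+ (a !)))))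

binom≡binomInt : ∀ x a → binom x a ≡ binomInt x a
binom≡binomInt x a = trans (cong (λ z → (z /ℕ (a !)) {{a ℕP.!≢0}}) (falling≡binomInt*a! x a))
                           (*-/ℕ-cancel (binomInt x a) (a !) {{a ℕP.!≢0}})

binom-pascal : ∀ x a → binom x (suc a) ≡ binom (x - 1ℤ) (suc a) + binom (x - 1ℤ) a
binom-pascal x a rewrite binom≡binomInt x (suc a) | binom≡binomInt (x - 1ℤ) (suc a) | binom≡binomInt (x - 1ℤ) a =
  ℤP.*-cancelʳ-≡ (B x (suc a)) (B (x - 1ℤ) (suc a) + B (x - 1ℤ) a) (+ (suc a !)) {{suc a ℕP.!≢0}} (begin
    B x (suc a) * + (suc a !)
      ≡⟨ falling≡binomInt*a! x (suc a) ⟨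
    falling x (suc a)
      ≡⟨ falling-pascal x a ⟩
    falling (x - 1ℤ) (suc a) + + suc a * falling (x - 1ℤ) a
      ≡⟨ cong₂ (λ u v → u + + suc a * v) (falling≡binomInt*a! (x - 1ℤ) (suc a)) (falling≡binomInt*a! (x - 1ℤ) a) ⟩
    B (x - 1ℤ) (suc a) * + (suc a !) + + suc a * (B (x - 1ℤ) a * + (a !))
      ≡⟨ cong (_+_ (B (x - 1ℤ) (suc a) * + (suc a !))) (swap (+ suc a) (B (x - 1ℤ) a) (+ (a !))) ⟩
    B (x - 1ℤ) (suc a) * + (suc a !) + B (x - 1ℤ) a * (+ suc a * + (a !))
      ≡⟨ cong (λ z → B (x - 1ℤ) (suc a) * + (suc a !) + B (x - 1ℤ) a * z) (ℤP.pos-* (suc a) (a !)) ⟨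
    B (x - 1ℤ) (suc a) * + (suc a !) + B (x - 1ℤ) a * + (suc a !)
      ≡⟨ ℤP.*-distribʳ-+ (+ (suc a !)) (B (x - 1ℤ) (suc a)) (B (x - 1ℤ) a) ⟨
    (B (x - 1ℤ) (suc a) + B (x - 1ℤ) a) * + (suc a !) ∎)
  where
  open ≡-Reasoning
  B : ℤ → ℕ → ℤ
  B = binomInt
  swap : ∀ s b f → s * (b * f) ≡ b * (s * f)
  swap = solve-∀

binom-vanish : ∀ m → binom (+ m) (suc m) ≡ 0ℤ
binom-vanish m = trans (binom≡binomInt (+ m) (suc m)) (cong +_ (k>n⇒nCk≡0 (ℕP.n<1+n m)))

infix 4 _≐[_]_
record _≐[_]_ (f : ArithFun) (N : ℕ) (g : ArithFun) : Set where
  constructor agreeUpTo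
  field atUpTo : ∀ n → 1 ≤ n → n ≤ N → f n ≡ g n
open _≐[_]_

≐[]-setoid : ℕ → Setoid _ _
≐[]-setoid N = record
  { Carrier       = ArithFun
  ; _≈_           = λ f g → f ≐[ N ] g
  ; isEquivalence = record
    { refl  = agreeUpTo (λ _ _ _ → refl)
    ; sym   = λ f≐g → agreeUpTo (λ n 1≤n n≤N → sym (atUpTo f≐g n 1≤n n≤N))
    ; trans = λ f≐g g≐h → agreeUpTo (λ n 1≤n n≤N → trans (atUpTo f≐g n 1≤n n≤N) (atUpTo g≐h n 1≤n n≤N))
    }
  }

≐⇒≐[] : ∀ {f g} N → f ≐ g → f ≐[ N ] g
≐⇒≐[] N f≐g = agreeUpTo (λ n 1≤n _ → at f≐g n 1≤n)

-- Agreement on 1, …, N survives convolution, as (f ⋆ W)(n) only uses f at the divisors of n.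
⋆-congˡ-≐[] : ∀ {f f' N} W → f ≐[ N ] f' → f ⋆ W ≐[ N ] f' ⋆ W
⋆-congˡ-≐[] {f} {f'} W f≐f' = agreeUpTo (λ n _ n≤N →
  ⋆-congˡ-upTo {f} {f'} W n (λ m 1≤m m≤n → atUpTo f≐f' m 1≤m (ℕP.≤-trans m≤n n≤N)))

-- If G(1) = 0 then G^{*k} vanishes at 1, …, k: a factorisation of m ≤ k into k parts
-- has a part equal to 1.
^⋆-vanish : ∀ G → G 1 ≡ 0ℤ → ∀ k m → 1 ≤ m → m ≤ k → (G ^⋆ k) m ≡ 0ℤ
^⋆-vanish G G1≡0 zero    m 1≤m m≤0 = ⊥-elim (ℕP.<⇒≱ 1≤m m≤0)
^⋆-vanish G G1≡0 (suc k) m 1≤m m≤k+1 =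
  trans (⋆-as-grid G (G ^⋆ k) m m ℕP.≤-refl)
        (sum-zero m (λ a _ → sum-zero m (λ b _ →
          trans (ifEq-cong (suc a *ℕ suc b) m (term a b)) (ifEq-0 (suc a *ℕ suc b) m))))
  where
  term : ∀ a b → suc a *ℕ suc b ≡ m → G (suc a) * (G ^⋆ k) (suc b) ≡ 0ℤ
  term zero    b _  = trans (cong (_* (G ^⋆ k) (suc b)) G1≡0) (ℤP.*-zeroˡ ((G ^⋆ k) (suc b)))
  term (suc a) b eq = trans (cong (G (suc (suc a)) *_) (^⋆-vanish G G1≡0 k (suc b) (s≤s z≤n) b+1≤k))
                            (ℤP.*-zeroʳ (G (suc (suc a))))
    where
    -- 2(b+1) ≤ (a+2)(b+1) = m ≤ k+1
    b+1≤k : suc b ≤ k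
    b+1≤k = ℕP.≤-trans (ℕP.m≤n+m (suc b) b)
              (ℕP.≤-pred (ℕP.≤-trans (ℕP.+-monoʳ-≤ (suc b) (ℕP.m≤n*m (suc b) (suc a)))
                                     (subst (_≤ suc k) (sym eq) m≤k+1)))

-- γ = (1 - e) ⋆ μ, so that μ = e - γ by Möbius inversion.
γ : ArithFun
γ = (one −ᶠ e) ⋆ μ

μ≐e−γ : μ ≐ e −ᶠ γ
μ≐e−γ = pointwise (λ n 1≤n → sym (begin
  e n - ((one −ᶠ e) ⋆ μ) n         ≡⟨ cong (_-_ (e n)) (⋆-distribʳ-− μ n one e) ⟩
  e n - ((one ⋆ μ) n - (e ⋆ μ) n)  ≡⟨ cong₂ (λ u v → e n - (u - v)) (at (≐-trans (⋆-comm one μ) möbius) n 1≤n)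
                                                                     (⋆-identityˡ-at μ n 1≤n) ⟩
  e n - (e n - μ n)                ≡⟨ cancel (e n) (μ n) ⟩
  μ n                              ∎))
  where
  open ≡-Reasoning
  cancel : ∀ x y → x - (x - y) ≡ y
  cancel = solve-∀

-- The coefficients (k+s-1 choose k) of the negative binomial series (e - γ)^{-s}.
coeff : ℤ → ℕ → ℤ
coeff s k = binom (+ k + s - 1ℤ) k

partialSum : ℤ → ℕ → ArithFun
partialSum s N n = sumBelow N (λ k → coeff s k * (γ ^⋆ k) n)

coeff-pascal : ∀ s k → coeff s (suc k) ≡ coeff (s - 1ℤ) (suc k) + coeff s k
coeff-pascal s k = trans (binom-pascal (+ suc k + s - 1ℤ) k)
  (cong₂ _+_ (cong (λ z → binom z (suc k)) (shift (+ suc k) s))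
             (cong (λ z → binom z k) (trans (cong (λ z → z + s - 1ℤ - 1ℤ) (ℤP.pos-+ 1 k)) (drop (+ k) s))))
  where
  shift : ∀ x s → x + s - 1ℤ - 1ℤ ≡ x + (s - 1ℤ) - 1ℤ
  shift = solve-∀
  drop : ∀ x s → 1ℤ + x + s - 1ℤ - 1ℤ ≡ x + s - 1ℤ
  drop = solve-∀

previousCoeff : ℤ → ℕ → ℤ
previousCoeff s zero    = 0ℤ
previousCoeff s (suc k) = coeff s k

coeff-difference : ∀ s N → coeff (s - 1ℤ) N ≡ coeff s N - previousCoeff s N
coeff-difference s zero    = refl
coeff-difference s (suc k) = trans (add-sub (coeff (s - 1ℤ) (suc k)) (coeff s k)) (cong (_- coeff s k) (sym (coeff-pascal s k)))
  where add-sub : ∀ x y → x ≡ x + y - y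
        add-sub = solve-∀

-- γ^{*k} ⋆ μ = γ^{*k} - γ^{*(k+1)}, as μ = e - γ.
γ^⋆-⋆-μ : ∀ k n → 1 ≤ n → ((γ ^⋆ k) ⋆ μ) n ≡ (γ ^⋆ k) n - (γ ^⋆ suc k) n
γ^⋆-⋆-μ k n 1≤n = begin
  ((γ ^⋆ k) ⋆ μ) n                   ≡⟨ at (⋆-congʳ (γ ^⋆ k) μ≐e−γ) n 1≤n ⟩
  ((γ ^⋆ k) ⋆ (e −ᶠ γ)) n            ≡⟨ ⋆-comm-at (γ ^⋆ k) (e −ᶠ γ) n ⟩
  ((e −ᶠ γ) ⋆ (γ ^⋆ k)) n            ≡⟨ ⋆-distribʳ-− (γ ^⋆ k) n e γ ⟩
  (e ⋆ (γ ^⋆ k)) n - (γ ^⋆ suc k) n  ≡⟨ cong (_- (γ ^⋆ suc k) n) (⋆-identityˡ-at (γ ^⋆ k) n 1≤n) ⟩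
  (γ ^⋆ k) n - (γ ^⋆ suc k) n        ∎
  where open ≡-Reasoning

-- Multiplying the partial sum by μ = e - γ telescopes, by Pascal's rule, to the partial sum
-- for s - 1 up to a boundary term in γ^{*N}.
partialSum-⋆-μ : ∀ s N n → 1 ≤ n →
  (partialSum s N ⋆ μ) n ≡ partialSum (s - 1ℤ) N n - previousCoeff s N * (γ ^⋆ N) n
partialSum-⋆-μ s zero    n 1≤n = trans (⋆-zeroˡ μ n) (zero-minus ((γ ^⋆ 0) n))
  where zero-minus : ∀ y → 0ℤ ≡ 0ℤ - 0ℤ * y
        zero-minus = solve-∀
partialSum-⋆-μ s (suc N) n 1≤n = begin
  (partialSum s (suc N) ⋆ μ) n
    ≡⟨ ⋆-distribʳ-+ μ n (partialSum s N) (λ m → b * (γ ^⋆ N) m) ⟩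
  (partialSum s N ⋆ μ) n + ((λ m → b * (γ ^⋆ N) m) ⋆ μ) n
    ≡⟨ cong₂ _+_ (partialSum-⋆-μ s N n 1≤n) (⋆-scaleˡ μ n b (γ ^⋆ N)) ⟩
  P - b' * x + b * ((γ ^⋆ N) ⋆ μ) n
    ≡⟨ cong (λ z → P - b' * x + b * z) (γ^⋆-⋆-μ N n 1≤n) ⟩
  P - b' * x + b * (x - y)
    ≡⟨ regroup P b' b x y ⟩
  P + (b - b') * x - b * y
    ≡⟨ cong (λ z → P + z * x - b * y) (coeff-difference s N) ⟨
  partialSum (s - 1ℤ) (suc N) n - b * y ∎
  where
  open ≡-Reasoning
  P b b' x y : ℤ
  P  = partialSum (s - 1ℤ) N n
  b  = coeff s N
  b' = previousCoeff s N
  x  = (γ ^⋆ N) n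
  y  = (γ ^⋆ suc N) n
  regroup : ∀ p b' b x y → p - b' * x + b * (x - y) ≡ p + (b - b') * x - b * y
  regroup = solve-∀

partialSum-⋆-μ-upTo : ∀ s N → partialSum s N ⋆ μ ≐[ N ] partialSum (s - 1ℤ) N
partialSum-⋆-μ-upTo s N = agreeUpTo (λ n 1≤n n≤N →
  trans (partialSum-⋆-μ s N n 1≤n)
        (trans (cong (λ z → partialSum (s - 1ℤ) N n - previousCoeff s N * z) (^⋆-vanish γ refl N n 1≤n n≤N))
               (drop-zero (partialSum (s - 1ℤ) N n) (previousCoeff s N))))
  where drop-zero : ∀ p b → p - b * 0ℤ ≡ p
        drop-zero = solve-∀

-- For s = 0 the series is just e: (k-1 choose k) = 0 for k ≥ 1.
partialSum-0 : ∀ N n → partialSum 0ℤ (suc N) n ≡ e n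
partialSum-0 zero    n = trans (ℤP.+-identityˡ (1ℤ * e n)) (ℤP.*-identityˡ (e n))
partialSum-0 (suc N) n =
  trans (cong₂ _+_ (partialSum-0 N n) (trans (cong (_* (γ ^⋆ suc N) n) coeff-0) (ℤP.*-zeroˡ ((γ ^⋆ suc N) n))))
        (ℤP.+-identityʳ (e n))
  where
  coeff-0 : coeff 0ℤ (suc N) ≡ 0ℤ
  coeff-0 = trans (cong (λ z → binom (z - 1ℤ) (suc N)) (ℤP.+-identityʳ (+ suc N)))
                  (trans (cong (λ z → binom z (suc N)) (pos-suc-1 N)) (binom-vanish N))

partialSum-0-upTo : ∀ N → e ≐[ N ] partialSum 0ℤ N
partialSum-0-upTo zero    = agreeUpTo (λ n 1≤n n≤0 → ⊥-elim (ℕP.<⇒≱ 1≤n n≤0))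
partialSum-0-upTo (suc N) = agreeUpTo (λ n _ _ → sym (partialSum-0 N n))

ℤ-induction : ∀ (P : ℤ → Set) → P 0ℤ →
              (∀ s → P (s - 1ℤ) → P s) → (∀ s → P s → P (s - 1ℤ)) → ∀ s → P s
ℤ-induction P P0 up down (+ zero)      = P0
ℤ-induction P P0 up down (+ suc k)     =
  up (+ suc k) (subst P (sym (pos-suc-1 k)) (ℤ-induction P P0 up down (+ k)))
ℤ-induction P P0 up down -[1+ zero ]   = down 0ℤ P0
ℤ-induction P P0 up down -[1+ suc k ]  =
  subst P (cong (λ z → -[1+ suc z ]) (ℕP.+-identityʳ k)) (down -[1+ k ] (ℤ-induction P P0 up down -[1+ k ]))

-- Both sides are multiplied by μ = 1^{*(-1)}
-- (going down) or by 1 (going up), starting from s = 0.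
onePow-expansion : ∀ s N → onePow s ≐[ N ] partialSum s N
onePow-expansion s N = ℤ-induction (λ s → onePow s ≐[ N ] partialSum s N) (partialSum-0-upTo N) up down s
  where
  open SetoidReasoning (≐[]-setoid N)
  down : ∀ s → onePow s ≐[ N ] partialSum s N → onePow (s - 1ℤ) ≐[ N ] partialSum (s - 1ℤ) N
  down s IH = begin
    onePow (s - 1ℤ)          ≈⟨ ≐⇒≐[] N (onePow-+ s (- 1ℤ)) ⟨
    onePow s ⋆ (μ ⋆ e)       ≈⟨ ≐⇒≐[] N (⋆-congʳ (onePow s) (⋆-identityʳ μ)) ⟩
    onePow s ⋆ μ             ≈⟨ ⋆-congˡ-≐[] μ IH ⟩
    partialSum s N ⋆ μ       ≈⟨ partialSum-⋆-μ-upTo s N ⟩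
    partialSum (s - 1ℤ) N    ∎
  up : ∀ s → onePow (s - 1ℤ) ≐[ N ] partialSum (s - 1ℤ) N → onePow s ≐[ N ] partialSum s N
  up s IH = begin
    onePow s                          ≈⟨ ≐⇒≐[] N (≐-reflexive (cong onePow (sub-add s))) ⟨
    onePow (s - 1ℤ + 1ℤ)              ≈⟨ ≐⇒≐[] N (onePow-+ (s - 1ℤ) 1ℤ) ⟨
    onePow (s - 1ℤ) ⋆ (one ⋆ e)       ≈⟨ ≐⇒≐[] N (⋆-congʳ (onePow (s - 1ℤ)) (⋆-identityʳ one)) ⟩
    onePow (s - 1ℤ) ⋆ one             ≈⟨ ⋆-congˡ-≐[] one IH ⟩
    partialSum (s - 1ℤ) N ⋆ one       ≈⟨ ⋆-congˡ-≐[] one (partialSum-⋆-μ-upTo s N) ⟨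
    (partialSum s N ⋆ μ) ⋆ one        ≈⟨ ≐⇒≐[] N (≐-trans (⋆-assoc (partialSum s N) μ one)
                                                  (≐-trans (⋆-congʳ (partialSum s N) möbius) (⋆-identityʳ (partialSum s N)))) ⟩
    partialSum s N                    ∎
    where sub-add : ∀ s → s - 1ℤ + 1ℤ ≡ s
          sub-add = solve-∀

negative-binomial-series : ∀ s W n M → 1 ≤ n → n ≤ M →
  sumBelow M (λ k → coeff s k * ((γ ^⋆ k) ⋆ W) n) ≡ (onePow s ⋆ W) n
negative-binomial-series s W n M 1≤n n≤M =
  trans (sym (⋆-sumˡ W n M (coeff s) (γ ^⋆_)))
        (sym (atUpTo (⋆-congˡ-≐[] W (onePow-expansion s M)) n 1≤n n≤M))

onePow-neg : ∀ i → onePow (- + i) ≐ μ ^⋆ i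
onePow-neg zero    = ≐-refl
onePow-neg (suc i) = ≐-refl

c-shift : ∀ k r i → c (k +ℕ i) (r - + i) ≐ (γ ^⋆ i) ⋆ c k r
c-shift k r i = begin
  (h ^⋆ (k +ℕ i)) ⋆ onePow (r - + i)
    ≈⟨ ⋆-cong (^⋆-+ h k i) (≐-sym (onePow-+ r (- + i))) ⟩
  ((h ^⋆ k) ⋆ (h ^⋆ i)) ⋆ (onePow r ⋆ onePow (- + i))
    ≈⟨ ⋆-congʳ ((h ^⋆ k) ⋆ (h ^⋆ i)) (⋆-congʳ (onePow r) (onePow-neg i)) ⟩
  ((h ^⋆ k) ⋆ (h ^⋆ i)) ⋆ (onePow r ⋆ (μ ^⋆ i))
    ≈⟨ ⋆-interchange (h ^⋆ k) (h ^⋆ i) (onePow r) (μ ^⋆ i) ⟩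
  c k r ⋆ ((h ^⋆ i) ⋆ (μ ^⋆ i))
    ≈⟨ ⋆-congʳ (c k r) (^⋆-distrib-⋆ h μ i) ⟨
  c k r ⋆ (γ ^⋆ i)
    ≈⟨ ⋆-comm (c k r) (γ ^⋆ i) ⟩
  (γ ^⋆ i) ⋆ c k r ∎
  where
  open ≐-Reasoning
  h : ArithFun
  h = one −ᶠ e

onePow-⋆-c : ∀ a k s → onePow a ⋆ c k s ≐ c k (a + s)
onePow-⋆-c a k s = begin
  onePow a ⋆ (H ⋆ onePow s)   ≈⟨ ⋆-assoc (onePow a) H (onePow s) ⟨
  (onePow a ⋆ H) ⋆ onePow s   ≈⟨ ⋆-congˡ (onePow s) (⋆-comm (onePow a) H) ⟩
  (H ⋆ onePow a) ⋆ onePow s   ≈⟨ ⋆-assoc H (onePow a) (onePow s) ⟩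
  H ⋆ (onePow a ⋆ onePow s)   ≈⟨ ⋆-congʳ H (onePow-+ a s) ⟩
  H ⋆ onePow (a + s)          ∎
  where
  open ≐-Reasoning
  H : ArithFun
  H = (one −ᶠ e) ^⋆ k

SeriesFrom-cong : ∀ {j t t' v v'} → (∀ k → t k ≡ t' k) → v ≡ v' → SeriesFrom j t v → SeriesFrom j t' v'
SeriesFrom-cong {j} t≡t' refl (K , converges) =
  K , λ M K≤M → trans (sum-cong M (λ i _ → sym (t≡t' (j +ℕ i)))) (converges M K≤M)

-- The second identity: with k = j + i the series becomes the negative binomial series
-- for 1^{*(j+r)} evaluated against c_{u+j}^{(v-j)}; it is exact once M ≥ n.
associated-expansion : ∀ r (j u : ℕ) (v : ℤ) (n : ℕ) → 1 ≤ n →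
  SeriesFrom j (λ k → binom (+ k + r - 1ℤ) (k ∸ j) * c (u +ℕ k) (v - + k) n) (c (j +ℕ u) (r + v) n)
associated-expansion r j u v n 1≤n = n , λ M n≤M → begin
  sumBelow M (λ i → binom (+ (j +ℕ i) + r - 1ℤ) ((j +ℕ i) ∸ j) * c (u +ℕ (j +ℕ i)) (v - + (j +ℕ i)) n)
    ≡⟨ sum-cong M (λ i _ → cong₂ _*_ (coefficient i) (at (shifted i) n 1≤n)) ⟩
  sumBelow M (λ i → coeff (+ j + r) i * ((γ ^⋆ i) ⋆ W) n)
    ≡⟨ negative-binomial-series (+ j + r) W n M 1≤n n≤M ⟩
  (onePow (+ j + r) ⋆ W) n
    ≡⟨ at (onePow-⋆-c (+ j + r) (u +ℕ j) (v - + j)) n 1≤n ⟩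
  c (u +ℕ j) (+ j + r + (v - + j)) n
    ≡⟨ cong₂ (λ k s → c k s n) (ℕP.+-comm u j) (cancel (+ j) r v) ⟩
  c (j +ℕ u) (r + v) n ∎
  where
  open ≡-Reasoning
  W : ArithFun
  W = c (u +ℕ j) (v - + j)
  cancel : ∀ a r v → a + r + (v - a) ≡ r + v
  cancel = solve-∀
  coefficient : ∀ i → binom (+ (j +ℕ i) + r - 1ℤ) ((j +ℕ i) ∸ j) ≡ coeff (+ j + r) i
  coefficient i = cong₂ binom (trans (cong (λ z → z + r - 1ℤ) (ℤP.pos-+ j i)) (regroup (+ j) (+ i) r))
                              (ℕP.m+n∸m≡n j i)
    where regroup : ∀ a b r → a + b + r - 1ℤ ≡ b + (a + r) - 1ℤ
          regroup = solve-∀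
  shifted : ∀ i → c (u +ℕ (j +ℕ i)) (v - + (j +ℕ i)) ≐ (γ ^⋆ i) ⋆ W
  shifted i = ≐-trans (≐-reflexive (cong₂ c (sym (ℕP.+-assoc u j i))
                                            (trans (cong (_-_ v) (ℤP.pos-+ j i)) (split v (+ j) (+ i)))))
                      (c-shift (u +ℕ j) (v - + j) i)
    where split : ∀ v a b → v - (a + b) ≡ v - a - b
          split = solve-∀

-- The first identity is the case j = u = v = 0, as c_0^{(r)} = e ⋆ 1^{*r} = d_r.
divisor-expansion : ∀ r (n : ℕ) → 1 ≤ n →
  SeriesFrom 0 (λ k → binom (+ k + r - 1ℤ) k * c k (- (+ k)) n) (d r n)
divisor-expansion r n 1≤n =
  SeriesFrom-cong {0} (λ k → cong (λ s → binom (+ k + r - 1ℤ) k * c k s n) (ℤP.+-identityˡ (- + k)))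
                  (trans (cong (λ s → (e ⋆ onePow s) n) (ℤP.+-identityʳ r)) (⋆-identityˡ-at (d r) n 1≤n))
                  (associated-expansion r 0 0 0ℤ n 1≤n)

theorem2 : (r : ℤ) →
    ((n : ℕ) → 1 ≤ n →
      SeriesFrom 0 (λ k → binom (+ k + r - 1ℤ) k * c k (- (+ k)) n) (d r n))
  × ((j u : ℕ) (v : ℤ) (n : ℕ) → 1 ≤ n →
      SeriesFrom j (λ k → binom (+ k + r - 1ℤ) (k ∸ j) * c (u +ℕ k) (v - + k) n)
        (c (j +ℕ u) (r + v) n))
theorem2 r = divisor-expansion r , associated-expansion r
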